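{- Let $k\ge 1$ and $Q_k=3^{2k}-3^k+1$ (ternary expansion $(2^k0^{k-1}1)_3$, i.e. $k$ digits $2$, then $k-1$ digits $0$, then a $1$). Then the path set $X(1,Q_k)$ has a path set presentation $(\mathcal{G}_k,v_0)$ with exactly $4^k$ vertices and $6\cdot 4^{k-1}$ edges, and the underlying graph of $\mathcal{G}_k$ is strongly connected.
   Context: $\mathbb{Z}_3$ denotes the $3$-adic integers; $\Sigma_3$ is the set of $3$-adic integers all of whose $3$-adic digits lie in $\{0,1\}$. For a positive integer $M$, $\mathcal{C}(1,M)=\{\alpha\in\mathbb{Z}_3:\alpha\in\Sigma_3,\ M\alpha\in\Sigma_3\}$ and $X(1,M)\subset\{0,1,2\}^{\mathbb{N}}$ is the set of $3$-adic digit sequences $(a_0,a_1,\dots)$ (with $\alpha=\sum a_j3^j$) of elements of $\mathcal{C}(1,M)$. A path set presentation of $X\subset\{0,1,2\}^{\mathbb{N}}$ is a finite directed graph with edges labeled by symbols of $\{0,1,2\}$ and a marked vertex $v$, such that $X$ is exactly the set of label sequences of infinite directed walks starting at $v$. -}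

module Defs where

open import Data.Nat using (ℕ; zero; suc; _+_; _*_; _∸_; _^_; _<_)
open import Data.Nat.Properties using (m^n≢0)
open import Data.Nat.DivMod using (_/_; _%_)
open import Data.Fin using (Fin; toℕ)
open import Data.Product using (Σ; _×_)
open import Relation.Binary.PropositionalEquality using (_≡_)
open import Function.Bundles using (_⇔_)

-- A 3-adic integer is represented by its digit sequence (a₀, a₁, …),
-- α = Σ aⱼ 3ʲ ; digits are elements of Fin 3 = {0,1,2}.
Digits : Set
Digits = ℕ → Fin 3

trunc : Digits → ℕ → ℕ
trunc a zero    = 0
trunc a (suc n) = trunc a n + toℕ (a n) * 3 ^ n

-- j-th 3-adic digit of M·α : it is determined by M·(α mod 3^{j+1}),
-- namely ⌊ M·(α mod 3^{j+1}) / 3ʲ ⌋ mod 3.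
mulDigit : ℕ → Digits → ℕ → ℕ
mulDigit M a j = (_/_ (M * trunc a (suc j)) (3 ^ j) {{m^n≢0 3 j}}) % 3

InΣ₃ : Digits → Set
InΣ₃ a = ∀ j → toℕ (a j) < 2

MulInΣ₃ : ℕ → Digits → Set
MulInΣ₃ M a = ∀ j → mulDigit M a j < 2

-- X(1,M) : digit sequences of α ∈ C(1,M) = {α ∈ Σ₃ : Mα ∈ Σ₃}
X1 : ℕ → Digits → Set
X1 M a = InΣ₃ a × MulInΣ₃ M a

record LabeledGraph : Set where
  field
    nV    : ℕ
    nE    : ℕ
    src   : Fin nE → Fin nV
    tgt   : Fin nE → Fin nV
    label : Fin nE → Fin 3
open LabeledGraph public

IsWalkFrom : (G : LabeledGraph) → Fin (nV G) → (ℕ → Fin (nE G)) → Set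
IsWalkFrom G v w = (src G (w 0) ≡ v) × (∀ n → tgt G (w n) ≡ src G (w (suc n)))

Generated : (G : LabeledGraph) → Fin (nV G) → Digits → Set
Generated G v a = Σ (ℕ → Fin (nE G)) λ w → IsWalkFrom G v w × (∀ n → label G (w n) ≡ a n)

Presents : (G : LabeledGraph) → Fin (nV G) → (Digits → Set) → Set
Presents G v X = ∀ a → X a ⇔ Generated G v a

data Path (G : LabeledGraph) : Fin (nV G) → Fin (nV G) → Set where
  nil  : ∀ {u} → Path G u u
  cons : ∀ {u v} (e : Fin (nE G)) → src G e ≡ u → Path G (tgt G e) v → Path G u v

StronglyConnected : LabeledGraph → Set
StronglyConnected G = ∀ u v → Path G u v

Q : ℕ → ℕ
Q k = 3 ^ (2 * k) ∸ 3 ^ k + 1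

module Submission where

-- Multiplying α = Σ aⱼ 3ʲ by M is a carry process: with cⱼ the carry into
-- position j, the j-th digit of Mα is (cⱼ + M aⱼ) mod 3 and c_{j+1} = ⌊(cⱼ + M aⱼ)/3⌋.
-- For M = Q_k = N² − N + 1 with N = 3ᵏ, every carry that occurs for α ∈ C(1,M) is
-- encoded by a window (x₀,…,x_{k−1}) of states of a 4-state transducer, as the value
-- Σ w(xᵢ) 3ⁱ with weights w = 0, 1, N − 1, N.  Reading aⱼ consumes x₀ by one of six
-- transitions x₀ → y and appends y at the end of the window; this is one step of the
-- carry process, and the transition's output is the digit of Mα.

open import Defs
open import Data.Nat using (ℕ; zero; suc; pred; _+_; _*_; _∸_; _^_; _≤_; _<_; z<s; s<s; NonZero)
open import Data.Nat.Properties
  using (m^n≢0; m*n≢0; *-comm; *-zeroʳ; +-comm; +-identityʳ; <-irrefl; m<n⇒m<1+n; m+n∸n≡m; ^-distribˡ-+-*; suc-pred)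
open import Data.Nat.DivMod
  using (_/_; _%_; +-distrib-/-∣ʳ; m*n/n≡m; m<n⇒m/n≡0; [m+kn]%n≡m%n; m<n⇒m%n≡m; m/n/o≡m/[n*o]; /-congˡ; /-congʳ; n/1≡n)
open import Data.Nat.Divisibility using (divides)
open import Data.Nat.Tactic.RingSolver using (solve-∀)
open import Data.Fin as Fin using (Fin; toℕ; combine; remQuot; funToFin; finToFun)
open import Data.Fin.Patterns using (0F; 1F; 2F; 3F; 4F; 5F)
open import Data.Fin.Properties using (remQuot-combine; funToFin-finToFin; finToFun-funToFin; toℕ<n)
open import Data.Vec as Vec using (Vec; []; _∷_; _∷ʳ_; head; tail; replicate; lookup; tabulate; toList)
open import Data.Vec.Properties
  using (tabulate-cong; tabulate∘lookup; lookup∘tabulate; toList-injective; toList-∷ʳ; toList-map)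
open import Data.Vec.Relation.Binary.Equality.Cast using (cast-is-id)
open import Data.Vec.Relation.Binary.Pointwise.Inductive using (Pointwise; []; _∷_)
open import Data.List as List using (List; _++_; [_])
open import Data.List.Properties using (++-assoc; ++-identityʳ)
open import Data.Empty using (⊥; ⊥-elim)
open import Data.Product using (Σ; Σ-syntax; _×_; _,_; proj₁; proj₂)
open import Function using (_∘_)
open import Function.Bundles using (mk⇔)
open import Relation.Binary.Construct.Closure.ReflexiveTransitive using (Star; ε; _◅_; _◅◅_)
open import Relation.Binary.PropositionalEquality
  using (_≡_; refl; sym; trans; cong; cong₂; subst; subst₂; module ≡-Reasoning)

module _ {s : ℕ} where

  encode : ∀ {n} → Vec (Fin s) n → Fin (s ^ n)
  encode v = funToFin (lookup v)

  decode : ∀ {n} → Fin (s ^ n) → Vec (Fin s) n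
  decode c = tabulate (finToFun c)

  decode-encode : ∀ {n} (v : Vec (Fin s) n) → decode (encode v) ≡ v
  decode-encode v = trans (tabulate-cong (finToFun-funToFin (lookup v))) (tabulate∘lookup v)

  encode-injective : ∀ {n} {v w : Vec (Fin s) n} → encode v ≡ encode w → v ≡ w
  encode-injective {v = v} {w} eq =
    trans (sym (decode-encode v)) (trans (cong decode eq) (decode-encode w))

  -- funToFin only depends on the values of its argument (no extensionality needed)
  funToFin-cong : ∀ {n} {f g : Fin n → Fin s} → (∀ i → f i ≡ g i) → funToFin f ≡ funToFin g
  funToFin-cong {zero}  _   = refl
  funToFin-cong {suc n} f≗g = cong₂ combine (f≗g 0F) (funToFin-cong (f≗g ∘ Fin.suc))

  encode-decode : ∀ {n} (c : Fin (s ^ n)) → encode (decode {n} c) ≡ c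
  encode-decode {n} c =
    trans (funToFin-cong (lookup∘tabulate (finToFun {s} {n} c))) (funToFin-finToFin {n} {s} c)

  toList-injective-≡ : ∀ {n} {u v : Vec (Fin s) n} → toList u ≡ toList v → u ≡ v
  toList-injective-≡ {u = u} {v} eq = trans (sym (cast-is-id refl u)) (toList-injective refl u v eq)

head-tail : ∀ {A : Set} {n} {x : A} (v : Vec A (suc n)) → x ≡ head v → x ∷ tail v ≡ v
head-tail (y ∷ v) refl = refl

module Automaton {s τ : ℕ} (from to : Fin τ → Fin s) where

  data Walk : ℕ → Fin s → Fin s → Set where
    stay : ∀ {x} → Walk 0 x x
    step : ∀ {n x y} (t : Fin τ) → from t ≡ x → Walk n (to t) y → Walk (suc n) x y

  infixr 5 _▸_
  _▸_ : ∀ {n y} (t : Fin τ) → Walk n (to t) y → Walk (suc n) (from t) y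
  t ▸ w = step t refl w

  data Shift : List (Fin s) → List (Fin s) → Set where
    shift : ∀ t r → Shift (from t List.∷ r) (r ++ [ to t ])

  round : ∀ (ts : List (Fin τ)) ys → Star Shift (List.map from ts ++ ys) (ys ++ List.map to ts)
  round List.[]       ys = subst (Star Shift ys) (sym (++-identityʳ ys)) ε
  round (t List.∷ ts) ys =
    shift t (List.map from ts ++ ys) ◅
    subst₂ (Star Shift) (sym (++-assoc (List.map from ts) ys [ to t ])) (++-assoc ys [ to t ] (List.map to ts))
      (round ts (ys ++ [ to t ]))

  round-vec : ∀ {n} (ts : Vec (Fin τ) n) → Star Shift (toList (Vec.map from ts)) (toList (Vec.map to ts))
  round-vec ts = subst₂ (Star Shift)
    (trans (++-identityʳ _) (sym (toList-map from ts))) (sym (toList-map to ts))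
    (round (toList ts) List.[])

  peel : ∀ {L n} {u v : Vec (Fin s) n} → Pointwise (Walk (suc L)) u v →
         Σ[ ts ∈ Vec (Fin τ) n ] (Vec.map from ts ≡ u × Pointwise (Walk L) (Vec.map to ts) v)
  peel []                   = [] , refl , []
  peel (step t refl w ∷ ws) with peel ws
  ... | ts , refl , ws′ = t ∷ ts , refl , w ∷ ws′

  stationary : ∀ {n} {u v : Vec (Fin s) n} → Pointwise (Walk 0) u v → u ≡ v
  stationary []                       = refl
  stationary {u = x ∷ _} (stay ∷ ws) = cong (x ∷_) (stationary ws)

  rounds : ∀ L {n} {u v : Vec (Fin s) n} → Pointwise (Walk L) u v → Star Shift (toList u) (toList v)
  rounds zero    ws rewrite stationary ws = ε
  rounds (suc L) ws with peel ws
  ... | ts , refl , ws′ = round-vec ts ◅◅ rounds L ws′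

-- The shift graph of a transducer with windows of length m + 1: the vertex of a window
-- is its code, and the edge coded by (t , r) leads from (from t ∷ r) to (r ∷ʳ to t),
-- labelled by the input symbol of t.
module ShiftGraph {s τ : ℕ} (from to : Fin τ → Fin s) (input : Fin τ → Fin 3) (m : ℕ) where
  open Automaton from to

  Window : Set
  Window = Vec (Fin s) (suc m)

  transitionOf : Fin (τ * s ^ m) → Fin τ
  transitionOf e = proj₁ (remQuot {τ} (s ^ m) e)

  restOf : Fin (τ * s ^ m) → Vec (Fin s) m
  restOf e = decode (proj₂ (remQuot {τ} (s ^ m) e))

  graph : LabeledGraph
  graph = record
    { nV    = s ^ suc m
    ; nE    = τ * s ^ m
    ; src   = λ e → encode (from (transitionOf e) ∷ restOf e)
    ; tgt   = λ e → encode (restOf e ∷ʳ to (transitionOf e))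
    ; label = input ∘ transitionOf
    }

  edge : Fin τ → Vec (Fin s) m → Fin (τ * s ^ m)
  edge t r = combine t (encode r)

  transitionOf-edge : ∀ t r → transitionOf (edge t r) ≡ t
  transitionOf-edge t r = cong proj₁ (remQuot-combine {τ} {s ^ m} t (encode r))

  restOf-edge : ∀ t r → restOf (edge t r) ≡ r
  restOf-edge t r =
    trans (cong (λ q → decode {n = m} (proj₂ q)) (remQuot-combine {τ} {s ^ m} t (encode r))) (decode-encode r)

  src-edge : ∀ t r → src graph (edge t r) ≡ encode (from t ∷ r)
  src-edge t r = cong₂ (λ t′ r′ → encode (from t′ ∷ r′)) (transitionOf-edge t r) (restOf-edge t r)

  tgt-edge : ∀ t r → tgt graph (edge t r) ≡ encode (r ∷ʳ to t)
  tgt-edge t r = cong₂ (λ t′ r′ → encode (r′ ∷ʳ to t′)) (transitionOf-edge t r) (restOf-edge t r)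

  record Run (v : Window) (a : Digits) : Set where
    field
      transition : ℕ → Fin τ
      rest       : ℕ → Vec (Fin s) m
      starts     : from (transition 0) ∷ rest 0 ≡ v
      shifts     : ∀ j → rest j ∷ʳ to (transition j) ≡ from (transition (suc j)) ∷ rest (suc j)
      reads      : ∀ j → input (transition j) ≡ a j

  run-of-walk : ∀ {v a} → Generated graph (encode v) a → Run v a
  run-of-walk (w , (starts , steps) , labels) = record
    { transition = transitionOf ∘ w
    ; rest       = restOf ∘ w
    ; starts     = encode-injective starts
    ; shifts     = encode-injective ∘ steps
    ; reads      = labels
    }

  walk-of-run : ∀ {v a} → Run v a → Generated graph (encode v) a
  walk-of-run {v} {a} ρ = w , (starts′ , steps) , labels
    where
    open Run ρ
    w : ℕ → Fin (τ * s ^ m)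
    w j = edge (transition j) (rest j)
    starts′ : src graph (w 0) ≡ encode v
    starts′ = trans (src-edge (transition 0) (rest 0)) (cong encode starts)
    steps : ∀ j → tgt graph (w j) ≡ src graph (w (suc j))
    steps j = trans (tgt-edge (transition j) (rest j))
      (trans (cong encode (shifts j)) (sym (src-edge (transition (suc j)) (rest (suc j)))))
    labels : ∀ j → label graph (w j) ≡ a j
    labels j = trans (cong input (transitionOf-edge (transition j) (rest j))) (reads j)

  shifts⇒path : ∀ {l l′} → Star Shift l l′ → ∀ {u v : Window} → toList u ≡ l → toList v ≡ l′ →
                Path graph (encode u) (encode v)
  shifts⇒path ε {u} refl eq = subst (Path graph (encode u) ∘ encode) (toList-injective-≡ (sym eq)) nil
  shifts⇒path (shift t r ◅ rest) {x ∷ u′} refl eq =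
    cons (edge t u′) (src-edge t u′)
      (subst (λ c → Path graph c _) (sym (tgt-edge t u′))
        (shifts⇒path rest (toList-∷ʳ (to t) u′) eq))

  strongly-connected : ∀ L → (∀ x y → Walk L x y) → StronglyConnected graph
  strongly-connected L walks c c′ =
    subst₂ (Path graph) (encode-decode {s} {suc m} c) (encode-decode {s} {suc m} c′)
      (shifts⇒path (rounds L (everywhere (decode {s} {suc m} c) (decode {s} {suc m} c′))) refl refl)
    where
    everywhere : ∀ {n} (u v : Vec (Fin s) n) → Pointwise (Walk L) u v
    everywhere []      []      = []
    everywhere (x ∷ u) (y ∷ v) = walks x y ∷ everywhere u v

/-+-multiple : ∀ x y d .{{_ : NonZero d}} → (x + y * d) / d ≡ x / d + y
/-+-multiple x y d = trans (+-distrib-/-∣ʳ x (divides y refl)) (cong (x / d +_) (m*n/n≡m y d))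

quotient-3 : ∀ o q → o < 3 → (o + q * 3) / 3 ≡ q
quotient-3 o q o<3 = trans (/-+-multiple o q 3) (cong (_+ q) (m<n⇒m/n≡0 o<3))

remainder-3 : ∀ o q → o < 3 → (o + q * 3) % 3 ≡ o
remainder-3 o q o<3 = trans ([m+kn]%n≡m%n o q 3) (m<n⇒m%n≡m o<3)

remainder-not-two : ∀ {n} q → n ≡ 2 + q * 3 → n % 3 < 2 → ⊥
remainder-not-two q refl lt = <-irrefl refl (subst (_< 2) (remainder-3 2 q (s<s (s<s z<s))) lt)

infixl 7 _/3^_
_/3^_ : ℕ → ℕ → ℕ
x /3^ j = _/_ x (3 ^ j) {{m^n≢0 3 j}}

module Carries (M : ℕ) (a : Digits) where

  carry : ℕ → ℕ
  carry j = M * trunc a j /3^ j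

  carry-zero : carry 0 ≡ 0
  carry-zero = trans (n/1≡n (M * 0)) (*-zeroʳ M)

  shifted-product : ∀ j → M * trunc a (suc j) /3^ j ≡ carry j + M * toℕ (a j)
  shifted-product j =
    trans (/-congˡ (distribute M (trunc a j) (toℕ (a j)) (3 ^ j)))
          (/-+-multiple (M * trunc a j) (M * toℕ (a j)) (3 ^ j))
    where
    distribute : ∀ M t d q → M * (t + d * q) ≡ M * t + M * d * q
    distribute = solve-∀
    instance
      3^j≢0 : NonZero (3 ^ j)
      3^j≢0 = m^n≢0 3 j

  digit-carry : ∀ j → mulDigit M a j ≡ (carry j + M * toℕ (a j)) % 3
  digit-carry j = cong (_% 3) (shifted-product j)

  carry-suc : ∀ j → carry (suc j) ≡ (carry j + M * toℕ (a j)) / 3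
  carry-suc j = begin
    M * trunc a (suc j) / (3 * 3 ^ j)  ≡⟨ /-congʳ (*-comm 3 (3 ^ j)) ⟩
    M * trunc a (suc j) / (3 ^ j * 3)  ≡⟨ m/n/o≡m/[n*o] (M * trunc a (suc j)) (3 ^ j) 3 ⟨
    M * trunc a (suc j) / 3 ^ j / 3    ≡⟨ cong (_/ 3) (shifted-product j) ⟩
    (carry j + M * toℕ (a j)) / 3      ∎
    where
    open ≡-Reasoning
    instance
      3^j≢0 : NonZero (3 ^ j)
      3^j≢0 = m^n≢0 3 j
      3^[1+j]≢0 : NonZero (3 * 3 ^ j)
      3^[1+j]≢0 = m^n≢0 3 (suc j)
      3^j*3≢0 : NonZero (3 ^ j * 3)
      3^j*3≢0 = m*n≢0 (3 ^ j) 3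

-- The transducer for M = N(N − 1) + 1 with N = 3(p + 1) (later N = 3ᵏ, so M = Q_k).
-- States carry the weights 0, 1, N − 1, N; the transitions, as
-- source --input/output--> target, are
--   0 --0/0--> 0,  0 --1/1--> 2,  1 --0/1--> 0,  2 --1/0--> 3,  3 --0/0--> 1,  3 --1/1--> 3.
module Transducer (p : ℕ) where

  M : ℕ
  M = 1 + (3 + 3 * p) * (2 + 3 * p)

  weight : Fin 4 → ℕ
  weight 0F = 0
  weight 1F = 1
  weight 2F = 2 + 3 * p
  weight 3F = 3 + 3 * p

  from to : Fin 6 → Fin 4
  from 0F = 0F
  from 1F = 0F
  from 2F = 1F
  from 3F = 2F
  from 4F = 3F
  from 5F = 3F
  to 0F = 0F
  to 1F = 2F
  to 2F = 0F
  to 3F = 3F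
  to 4F = 1F
  to 5F = 3F

  input : Fin 6 → Fin 3
  input 0F = 0F
  input 1F = 1F
  input 2F = 0F
  input 3F = 1F
  input 4F = 0F
  input 5F = 1F

  output : Fin 6 → Fin 2
  output 0F = 0F
  output 1F = 1F
  output 2F = 1F
  output 3F = 0F
  output 4F = 0F
  output 5F = 1F

  input<2 : ∀ t → toℕ (input t) < 2
  input<2 0F = z<s
  input<2 1F = s<s z<s
  input<2 2F = z<s
  input<2 3F = s<s z<s
  input<2 4F = z<s
  input<2 5F = s<s z<s

  key : ∀ t → weight (from t) + M * toℕ (input t) ≡ toℕ (output t) + weight (to t) * suc p * 3
  key 0F = *-zeroʳ M
  key 1F = read-one p
    where
    read-one : ∀ p → 0 + (1 + (3 + 3 * p) * (2 + 3 * p)) * 1 ≡ 1 + (2 + 3 * p) * (1 + p) * 3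
    read-one = solve-∀
  key 2F = cong (1 +_) (*-zeroʳ M)
  key 3F = climb p
    where
    climb : ∀ p → (2 + 3 * p) + (1 + (3 + 3 * p) * (2 + 3 * p)) * 1 ≡ 0 + (3 + 3 * p) * (1 + p) * 3
    climb = solve-∀
  key 4F = descend p
    where
    descend : ∀ p → (3 + 3 * p) + (1 + (3 + 3 * p) * (2 + 3 * p)) * 0 ≡ 0 + 1 * (1 + p) * 3
    descend = solve-∀
  key 5F = stay-high p
    where
    stay-high : ∀ p → (3 + 3 * p) + (1 + (3 + 3 * p) * (2 + 3 * p)) * 1 ≡ 1 + (3 + 3 * p) * (1 + p) * 3
    stay-high = solve-∀

  value : ∀ {n} → Vec (Fin 4) n → ℕ
  value []       = 0
  value (x ∷ xs) = weight x + value xs * 3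

  value-zeros : ∀ n → value (replicate n 0F) ≡ 0
  value-zeros zero    = refl
  value-zeros (suc n) = cong (_* 3) (value-zeros n)

  value-∷ʳ : ∀ {n} (xs : Vec (Fin 4) n) y → value (xs ∷ʳ y) ≡ value xs + weight y * 3 ^ n
  value-∷ʳ []       y = single (weight y)
    where
    single : ∀ w → w + 0 * 3 ≡ 0 + w * 1
    single = solve-∀
  value-∷ʳ {suc n} (x ∷ xs) y = begin
    weight x + value (xs ∷ʳ y) * 3                   ≡⟨ cong (λ v → weight x + v * 3) (value-∷ʳ xs y) ⟩
    weight x + (value xs + weight y * 3 ^ n) * 3     ≡⟨ regroup (weight x) (value xs) (weight y) (3 ^ n) ⟩
    weight x + value xs * 3 + weight y * (3 * 3 ^ n) ∎
    where
    open ≡-Reasoning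
    regroup : ∀ w c v q → w + (c + v * q) * 3 ≡ w + c * 3 + v * (3 * q)
    regroup = solve-∀

  -- With windows of length m + 1 and 3^m = p + 1 (so N = 3^{m+1}), one shift of the window
  -- performs one step of the carry process: value + M·input = output + 3·(new value).
  transition-law : ∀ {m} → 3 ^ m ≡ suc p → ∀ t (r : Vec (Fin 4) m) →
                   value (from t ∷ r) + M * toℕ (input t) ≡ toℕ (output t) + value (r ∷ʳ to t) * 3
  transition-law {m} 3^m≡1+p t r = begin
    weight (from t) + value r * 3 + M * toℕ (input t)  ≡⟨ swap (weight (from t)) (value r * 3) (M * toℕ (input t)) ⟩
    weight (from t) + M * toℕ (input t) + value r * 3  ≡⟨ cong (_+ value r * 3) (key t) ⟩
    o + weight (to t) * suc p * 3 + value r * 3        ≡⟨ collect o (weight (to t) * suc p) (value r) ⟩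
    o + (value r + weight (to t) * suc p) * 3          ≡⟨ cong (λ q → o + (value r + weight (to t) * q) * 3) 3^m≡1+p ⟨
    o + (value r + weight (to t) * 3 ^ m) * 3          ≡⟨ cong (λ v → o + v * 3) (value-∷ʳ r (to t)) ⟨
    o + value (r ∷ʳ to t) * 3                          ∎
    where
    open ≡-Reasoning
    o = toℕ (output t)
    swap : ∀ w c k → w + c + k ≡ w + k + c
    swap = solve-∀
    collect : ∀ o v c → o + v * 3 + c * 3 ≡ o + (c + v) * 3
    collect = solve-∀

  output<3 : ∀ t → toℕ (output t) < 3
  output<3 t = m<n⇒m<1+n (toℕ<n (output t))

  law-quotient : ∀ {m} → 3 ^ m ≡ suc p → ∀ t (r : Vec (Fin 4) m) →
                 value (r ∷ʳ to t) ≡ (value (from t ∷ r) + M * toℕ (input t)) / 3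
  law-quotient 3^m≡1+p t r =
    sym (trans (cong (_/ 3) (transition-law 3^m≡1+p t r))
               (quotient-3 (toℕ (output t)) (value (r ∷ʳ to t)) (output<3 t)))

  law-remainder : ∀ {m} → 3 ^ m ≡ suc p → ∀ t (r : Vec (Fin 4) m) →
                  (value (from t ∷ r) + M * toℕ (input t)) % 3 ≡ toℕ (output t)
  law-remainder 3^m≡1+p t r =
    trans (cong (_% 3) (transition-law 3^m≡1+p t r))
          (remainder-3 (toℕ (output t)) (value (r ∷ʳ to t)) (output<3 t))

  -- The transitions cover every admissible step: if the input digit d and the resulting
  -- digit of the product are both 0 or 1, some transition leaves x reading d.  (The two
  -- missing pairs, state 1 reading 1 and state 2 reading 0, would produce the digit 2.)
  admissible : ∀ {n} x d (r : Vec (Fin 4) n) → toℕ d < 2 → (value (x ∷ r) + M * toℕ d) % 3 < 2 →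
               Σ[ t ∈ Fin 6 ] (from t ≡ x × input t ≡ d)
  admissible 0F 0F _ _ _  = 0F , refl , refl
  admissible 0F 1F _ _ _  = 1F , refl , refl
  admissible 1F 0F _ _ _  = 2F , refl , refl
  admissible 1F 1F r _ ok = ⊥-elim (remainder-not-two (value r + suc p * (2 + 3 * p)) (one-one p (value r)) ok)
    where
    one-one : ∀ p v → 1 + v * 3 + (1 + (3 + 3 * p) * (2 + 3 * p)) * 1 ≡ 2 + (v + (1 + p) * (2 + 3 * p)) * 3
    one-one = solve-∀
  admissible 2F 0F r _ ok = ⊥-elim (remainder-not-two (p + value r) (two-zero p (value r)) ok)
    where
    two-zero : ∀ p v → (2 + 3 * p) + v * 3 + (1 + (3 + 3 * p) * (2 + 3 * p)) * 0 ≡ 2 + (p + v) * 3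
    two-zero = solve-∀
  admissible 2F 1F _ _ _  = 3F , refl , refl
  admissible 3F 0F _ _ _  = 4F , refl , refl
  admissible 3F 1F _ _ _  = 5F , refl , refl
  admissible _  2F _ (s<s (s<s ())) _

  open Automaton from to using (Walk; stay; _▸_)

  walk4 : ∀ x y → Walk 4 x y
  walk4 0F 0F = 0F ▸ 0F ▸ 0F ▸ 0F ▸ stay
  walk4 0F 1F = 0F ▸ 1F ▸ 3F ▸ 4F ▸ stay
  walk4 0F 2F = 0F ▸ 0F ▸ 0F ▸ 1F ▸ stay
  walk4 0F 3F = 0F ▸ 0F ▸ 1F ▸ 3F ▸ stay
  walk4 1F 0F = 2F ▸ 0F ▸ 0F ▸ 0F ▸ stay
  walk4 1F 1F = 2F ▸ 1F ▸ 3F ▸ 4F ▸ stay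
  walk4 1F 2F = 2F ▸ 0F ▸ 0F ▸ 1F ▸ stay
  walk4 1F 3F = 2F ▸ 0F ▸ 1F ▸ 3F ▸ stay
  walk4 2F 0F = 3F ▸ 4F ▸ 2F ▸ 0F ▸ stay
  walk4 2F 1F = 3F ▸ 5F ▸ 5F ▸ 4F ▸ stay
  walk4 2F 2F = 3F ▸ 4F ▸ 2F ▸ 1F ▸ stay
  walk4 2F 3F = 3F ▸ 5F ▸ 5F ▸ 5F ▸ stay
  walk4 3F 0F = 4F ▸ 2F ▸ 0F ▸ 0F ▸ stay
  walk4 3F 1F = 5F ▸ 5F ▸ 5F ▸ 4F ▸ stay
  walk4 3F 2F = 4F ▸ 2F ▸ 0F ▸ 1F ▸ stay
  walk4 3F 3F = 4F ▸ 2F ▸ 1F ▸ 3F ▸ stay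

Q-value : ∀ m p → 3 ^ m ≡ suc p → Q (suc m) ≡ Transducer.M p
Q-value m p 3^m≡1+p = begin
  3 ^ (2 * k) ∸ 3 ^ k + 1                ≡⟨ cong (λ x → x ∸ 3 ^ k + 1) square ⟩
  3 ^ k * 3 ^ k ∸ 3 ^ k + 1              ≡⟨ cong (λ N → N * N ∸ N + 1) (cong (3 *_) 3^m≡1+p) ⟩
  N * N ∸ N + 1                          ≡⟨ cong (λ x → x ∸ N + 1) (expand p) ⟩
  (3 + 3 * p) * (2 + 3 * p) + N ∸ N + 1  ≡⟨ cong (_+ 1) (m+n∸n≡m ((3 + 3 * p) * (2 + 3 * p)) N) ⟩
  (3 + 3 * p) * (2 + 3 * p) + 1          ≡⟨ +-comm ((3 + 3 * p) * (2 + 3 * p)) 1 ⟩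
  Transducer.M p                         ∎
  where
  open ≡-Reasoning
  k = suc m
  N = 3 * suc p
  square : 3 ^ (2 * k) ≡ 3 ^ k * 3 ^ k
  square = trans (cong (λ e → 3 ^ (k + e)) (+-identityʳ k)) (^-distribˡ-+-* 3 k k)
  expand : ∀ p → 3 * suc p * (3 * suc p) ≡ (3 + 3 * p) * (2 + 3 * p) + 3 * suc p
  expand = solve-∀

module Presentation (m p : ℕ) (3^m≡1+p : 3 ^ m ≡ suc p) where
  open Transducer p
  open ShiftGraph from to input m

  start : Window
  start = replicate (suc m) 0F

  module _ (a : Digits) where
    open Carries M a

    carry-step : ∀ j t (r : Vec (Fin 4) m) → value (from t ∷ r) ≡ carry j → input t ≡ a j →
                 value (r ∷ʳ to t) ≡ carry (suc j)
    carry-step j t r v≡c reads = begin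
      value (r ∷ʳ to t)                              ≡⟨ law-quotient 3^m≡1+p t r ⟩
      (value (from t ∷ r) + M * toℕ (input t)) / 3   ≡⟨ cong₂ (λ c d → (c + M * toℕ d) / 3) v≡c reads ⟩
      (carry j + M * toℕ (a j)) / 3                  ≡⟨ carry-suc j ⟨
      carry (suc j)                                  ∎
      where open ≡-Reasoning

    run-carries : (ρ : Run start a) → ∀ j → value (from (Run.transition ρ j) ∷ Run.rest ρ j) ≡ carry j
    run-carries ρ zero    = trans (cong value starts) (trans (value-zeros (suc m)) (sym carry-zero))
      where open Run ρ
    run-carries ρ (suc j) =
      trans (cong value (sym (shifts j))) (carry-step j (transition j) (rest j) (run-carries ρ j) (reads j))
      where open Run ρ

    -- so a run reads digits 0/1 and the digits of the product are its outputs
    run⇒X1 : Run start a → X1 M a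
    run⇒X1 ρ = digits , products
      where
      open Run ρ
      open ≡-Reasoning
      digits : InΣ₃ a
      digits j = subst (λ d → toℕ d < 2) (reads j) (input<2 (transition j))
      product-digit : ∀ j → mulDigit M a j ≡ toℕ (output (transition j))
      product-digit j = begin
        mulDigit M a j                                  ≡⟨ digit-carry j ⟩
        (carry j + M * toℕ (a j)) % 3                   ≡⟨ cong₂ (λ c d → (c + M * toℕ d) % 3) (run-carries ρ j) (reads j) ⟨
        (value (from (transition j) ∷ rest j) + M * toℕ (input (transition j))) % 3
                                                        ≡⟨ law-remainder 3^m≡1+p (transition j) (rest j) ⟩
        toℕ (output (transition j))                     ∎
      products : MulInΣ₃ M a
      products j = subst (_< 2) (sym (product-digit j)) (toℕ<n (output (transition j)))

    -- Conversely, for α ∈ C(1,M) the run is built step by step: the window holding the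
    -- current carry always admits a transition reading the next digit.
    X1⇒run : X1 M a → Run start a
    X1⇒run (digits , products) = record
      { transition = transition
      ; rest       = tail ∘ window
      ; starts     = enters 0
      ; shifts     = λ j → sym (enters (suc j))
      ; reads      = λ j → proj₂ (proj₂ (choice j))
      }
      where
      visit : ∀ j → Σ[ v ∈ Window ] value v ≡ carry j
      window : ℕ → Window
      choice : ∀ j → Σ[ t ∈ Fin 6 ] (from t ≡ head (window j) × input t ≡ a j)
      transition : ℕ → Fin 6
      enters : ∀ j → from (transition j) ∷ tail (window j) ≡ window j

      admissible-at : ∀ j (v : Window) → value v ≡ carry j → Σ[ t ∈ Fin 6 ] (from t ≡ head v × input t ≡ a j)
      admissible-at j (x ∷ r) v≡c = admissible x (a j) r (digits j)
        (subst (_< 2) (trans (digit-carry j) (cong (λ c → (c + M * toℕ (a j)) % 3) (sym v≡c))) (products j))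

      window j = proj₁ (visit j)
      choice j = admissible-at j (window j) (proj₂ (visit j))
      transition j = proj₁ (choice j)
      enters j = head-tail (window j) (proj₁ (proj₂ (choice j)))
      visit zero    = start , trans (value-zeros (suc m)) (sym carry-zero)
      visit (suc j) = tail (window j) ∷ʳ to (transition j) ,
        carry-step j (transition j) (tail (window j)) (trans (cong value (enters j)) (proj₂ (visit j)))
          (proj₂ (proj₂ (choice j)))

  presents : Presents graph (encode start) (X1 M)
  presents a = mk⇔ (walk-of-run ∘ X1⇒run a) (run⇒X1 a ∘ run-of-walk)

theorem2p3 : ∀ (k : ℕ) → 1 ≤ k →
    Σ LabeledGraph λ G → Σ (Fin (nV G)) λ v₀ →
      Presents G v₀ (X1 (Q k)) × nV G ≡ 4 ^ k × nE G ≡ 6 * 4 ^ (k ∸ 1) × StronglyConnected G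
theorem2p3 zero    ()
theorem2p3 (suc m) _ =
  graph , encode start ,
  subst (Presents graph (encode start) ∘ X1) (sym (Q-value m p 3^m≡1+p)) presents ,
  refl , refl , strongly-connected 4 walk4
  where
  p = pred (3 ^ m)
  3^m≡1+p : 3 ^ m ≡ suc p
  3^m≡1+p = sym (suc-pred (3 ^ m) {{m^n≢0 3 m}})
  open Transducer p using (from; to; input; walk4)
  open ShiftGraph from to input m using (graph; strongly-connected)
  open Presentation m p 3^m≡1+p using (start; presents)
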